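{- For every permutation $w\in S_n$, the number of pseudo-percentage-avoiding fillings of the south-east diagram $E_w$ equals the number of acyclic orientations of the inversion graph $G_w$.
   Context: For $w=w_1\cdots w_n\in S_n$: the inversion graph $G_w$ has vertex set $[n]=\{1,\dots,n\}$ and edges $\{i,j\}$ for all $i<j$ with $w_i>w_j$. The entries of $w$ are the cells $(i,w_i)$. The south-east diagram is $E_w=\{(i,w_j):1\le i<j\le n,\ w_j<w_i\}\subseteq[n]\times[n]$. A filling of $E_w$ is a map $A:E_w\to\{0,1\}$; it is pseudo-percentage-avoiding if: (a) whenever $(i,j),(i',j),(i,j'),(i',j')$ all lie in $E_w$, it is not the case that $A_{i,j}=A_{i',j'}=1$ and $A_{i',j}=A_{i,j'}=0$, nor that $A_{i,j}=A_{i',j'}=0$ and $A_{i',j}=A_{i,j'}=1$; and (b) whenever $(i,j),(i',j),(i,j')$ lie in $E_w$ and $j'=w_{i'}$, it is not the case that $A_{i,j}=1$ and $A_{i',j}=A_{i,j'}=0$, nor that $A_{i,j}=0$ and $A_{i',j}=A_{i,j'}=1$. -}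

module Defs where

open import Data.Nat using (ℕ; zero; suc)
open import Data.Fin using (Fin; zero; suc; _<_)
open import Data.Fin.Permutation using (Permutation′; _⟨$⟩ʳ_)
open import Data.Bool using (Bool; true; false)
open import Data.List using (List; []; _∷_; map; concatMap)
open import Data.Product using (_×_; ∃-syntax; Σ-syntax)
open import Data.Sum using (_⊎_)
open import Relation.Nullary using (¬_)
open import Relation.Binary.PropositionalEquality using (_≡_)

-- Conventions: [n] is modelled by Fin n (0-based); w i is  w ⟨$⟩ʳ i.

allFns : {A : Set} (m : ℕ) → List A → List (Fin m → A)
allFns zero    xs = (λ ()) ∷ []
allFns (suc m) xs =
  concatMap (λ x → map (λ f → λ { zero → x ; (suc i) → f i }) (allFns m xs)) xs

allMatrices : (n : ℕ) → List (Fin n → Fin n → Bool)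
allMatrices n = allFns n (allFns n (true ∷ false ∷ []))

data Count {A : Set} (P : A → Set) : List A → ℕ → Set where
  nil  : Count P [] zero
  yes  : ∀ {x xs k} → P x → Count P xs k → Count P (x ∷ xs) (suc k)
  no   : ∀ {x xs k} → ¬ P x → Count P xs k → Count P (x ∷ xs) k

InE : {n : ℕ} → Permutation′ n → Fin n → Fin n → Set
InE w r c = ∃[ j ] (r < j × (w ⟨$⟩ʳ j) < (w ⟨$⟩ʳ r) × c ≡ w ⟨$⟩ʳ j)

-- A filling of E_w is represented by a 0/1 matrix vanishing outside E_w
-- (this is in bijection with maps E_w → {0,1}).
SupportedOn : {n : ℕ} → Permutation′ n → (Fin n → Fin n → Bool) → Set
SupportedOn w A = ∀ r c → A r c ≡ true → InE w r c

ConditionA : {n : ℕ} → Permutation′ n → (Fin n → Fin n → Bool) → Set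
ConditionA w A = ∀ i i' j j' →
  InE w i j → InE w i' j → InE w i j' → InE w i' j' →
  ¬ (A i j ≡ true × A i' j' ≡ true × A i' j ≡ false × A i j' ≡ false) ×
  ¬ (A i j ≡ false × A i' j' ≡ false × A i' j ≡ true × A i j' ≡ true)

ConditionB : {n : ℕ} → Permutation′ n → (Fin n → Fin n → Bool) → Set
ConditionB w A = ∀ i i' j j' →
  InE w i j → InE w i' j → InE w i j' → j' ≡ w ⟨$⟩ʳ i' →
  ¬ (A i j ≡ true × A i' j ≡ false × A i j' ≡ false) ×
  ¬ (A i j ≡ false × A i' j ≡ true × A i j' ≡ true)

PPAFilling : {n : ℕ} → Permutation′ n → (Fin n → Fin n → Bool) → Set
PPAFilling w A = SupportedOn w A × ConditionA w A × ConditionB w A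

Edge : {n : ℕ} → Permutation′ n → Fin n → Fin n → Set
Edge w i j = (i < j × (w ⟨$⟩ʳ j) < (w ⟨$⟩ʳ i)) ⊎ (j < i × (w ⟨$⟩ʳ i) < (w ⟨$⟩ʳ j))

-- An orientation is a 0/1 matrix O with O i j = true meaning arc i → j:
-- arcs only along edges, and each edge gets exactly one direction.
IsOrientation : {n : ℕ} → Permutation′ n → (Fin n → Fin n → Bool) → Set
IsOrientation w O =
  (∀ i j → O i j ≡ true → Edge w i j) ×
  (∀ i j → Edge w i j →
     (O i j ≡ true × O j i ≡ false) ⊎ (O i j ≡ false × O j i ≡ true))

Walk : {n : ℕ} → (Fin n → Fin n → Bool) → Fin n → Fin n → ℕ → Set
Walk O u v zero    = u ≡ v
Walk O u v (suc k) = ∃[ x ] (O u x ≡ true × Walk O x v k)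

Acyclic : {n : ℕ} → (Fin n → Fin n → Bool) → Set
Acyclic O = ∀ v k → ¬ Walk O v v (suc k)

AcyclicOrientation : {n : ℕ} → Permutation′ n → (Fin n → Fin n → Bool) → Set
AcyclicOrientation w O = IsOrientation w O × Acyclic O

-- Cells of E_w are the edges of G_w: the cell (i , w j) with i < j and w j < w i is the
-- edge {i , j}, and a 0/1 entry in it chooses an orientation of that edge.  Under this
-- bijection condition (b) forbids exactly the directed triangles, and condition (a) the
-- directed 4-cycles x → y → z → t → x in which x, z precede y, t and exceed them in value.
-- An orientation of G_w avoiding both is acyclic: rotate a cycle to start at its leftmost
-- vertex b → c ⇝ a → b; comparing c with a, and then with the vertex after c (or, by
-- reversing all arcs, before a), always yields a forbidden triangle or square, or a shorter
-- cycle.  Both sides are counted in an enumeration of the matrices without repetitions up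
-- to pointwise equality, so the bijection gives equal counts.
module Submission where

open import Defs hiding (yes; no)
open import Level using (0ℓ)
open import Data.Nat using (ℕ; zero; suc; _+_)
import Data.Nat as ℕ
import Data.Nat.Properties as ℕ
open import Data.Nat.Induction using (<-rec)
open import Data.Fin using (Fin; zero; suc; _<_; _≤_; _<?_; _≤?_)
open import Data.Fin.Properties
  using (_≟_; any?; all?; <-cmp; <-trans; <-asym; <-irrefl; <⇒≢; ≤-trans; ≤-refl; ≤∧≢⇒<; injective⇒≤)
open import Data.Fin.Permutation using (Permutation′; _⟨$⟩ʳ_; _⟨$⟩ˡ_; inverseˡ)
open import Data.Bool using (Bool; true; false; not)
open import Data.Bool.Properties using (not-¬; ¬-not; not-injective) renaming (_≟_ to _≟ᵇ_)
open import Data.List using (List; []; _∷_; length; lookup; filter)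
open import Data.List.Relation.Unary.Any using (here; there)
import Data.List.Relation.Unary.Any as Any
import Data.List.Relation.Unary.Any.Properties as Any
open import Data.List.Relation.Unary.All as All using ([]; _∷_)
import Data.List.Relation.Unary.All.Properties as All
open import Data.List.Relation.Unary.AllPairs as AllPairs using ([]; _∷_)
import Data.List.Relation.Unary.AllPairs.Properties as AllPairs
import Data.List.Membership.Setoid as Membership
open import Data.List.Membership.Setoid.Properties
  using (∈-lookup; index-injective; ∈-filter⁺; ∈-filter⁻; ∈-concatMap⁺)
import Data.List.Membership.Propositional.Properties as Propositional
open import Data.List.Relation.Unary.Unique.Setoid using (Unique)
import Data.List.Relation.Unary.Unique.Setoid.Properties as Unique
open import Data.List.Relation.Binary.Disjoint.Setoid using (Disjoint)
import Data.Vec.Functional.Relation.Binary.Equality.Setoid as Pointwise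
open import Data.Product using (_×_; _,_; ∃-syntax; proj₁; proj₂)
import Data.Product as Product
open import Data.Sum using (_⊎_; inj₁; inj₂; swap; [_,_]′)
import Data.Sum as Sum
open import Function using (flip; _∘_)
open import Relation.Binary using (Setoid; tri<; tri≈; tri>)
open import Relation.Binary.PropositionalEquality using (_≡_; refl; sym; trans; cong; subst)
import Relation.Binary.PropositionalEquality as ≡
open import Relation.Nullary using (¬_; Dec; yes; no; contradiction)
open import Relation.Nullary.Decidable using (_×-dec_; _⊎-dec_; _→-dec_; ¬?; decidable-stable)
open import Relation.Unary using (Decidable)

count-filter : {A : Set} {P : A → Set} (P? : Decidable P) (xs : List A) →
  Count P xs (length (filter P? xs))
count-filter P? []       = nil
count-filter P? (x ∷ xs) with P? x
... | yes p = Count.yes p (count-filter P? xs)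
... | no ¬p = Count.no ¬p (count-filter P? xs)

module _ (S : Setoid 0ℓ 0ℓ) where

  open Setoid S using (_≈_)
    renaming (Carrier to A; refl to ≈-refl; sym to ≈-sym; trans to ≈-trans)
  open Membership S using (_∈_)

  lookup-injective : ∀ {xs} → Unique S xs → ∀ i j → lookup xs i ≈ lookup xs j → i ≡ j
  lookup-injective (_  ∷ _)   zero    zero    _  = refl
  lookup-injective (x∉ ∷ _)   zero    (suc j) eq =
    contradiction eq (All.lookup x∉ (Propositional.∈-lookup j))
  lookup-injective (x∉ ∷ _)   (suc i) zero    eq =
    contradiction (≈-sym eq) (All.lookup x∉ (Propositional.∈-lookup i))
  lookup-injective (_  ∷ xs!) (suc i) (suc j) eq = cong suc (lookup-injective xs! i j eq)

  injective⇒length-≤ : ∀ {xs ys} (f : A → A) → Unique S xs →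
    (∀ {x y} → x ∈ xs → y ∈ xs → f x ≈ f y → x ≈ y) → (∀ {x} → x ∈ xs → f x ∈ ys) →
    length xs ℕ.≤ length ys
  injective⇒length-≤ {xs} f xs! f-injective f-into = injective⇒≤ λ {i} {j} eq →
    lookup-injective xs! i j (f-injective (∈-lookup S xs i) (∈-lookup S xs j)
      (index-injective S (f-into (∈-lookup S xs i)) (f-into (∈-lookup S xs j)) eq))

  module _ {L : List A} (complete : ∀ x → x ∈ L) (L! : Unique S L) where

    length-filter-≤ : ∀ {P Q : A → Set} (P? : Decidable P) (Q? : Decidable Q) →
      (∀ {x y} → x ≈ y → P x → P y) → (∀ {x y} → x ≈ y → Q x → Q y) →
      (f g : A → A) → (∀ {x y} → x ≈ y → g x ≈ g y) →
      (∀ {x} → P x → Q (f x)) → (∀ {x} → P x → g (f x) ≈ x) →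
      length (filter P? L) ℕ.≤ length (filter Q? L)
    length-filter-≤ {P} P? Q? P-resp Q-resp f g g-cong P⇒Q gf≈id =
      injective⇒length-≤ f (Unique.filter⁺ S P? L!) f-injective f-into
      where
        P-filtered : ∀ {x} → x ∈ filter P? L → P x
        P-filtered x∈ = proj₂ (∈-filter⁻ S P? P-resp {xs = L} x∈)

        f-injective : ∀ {x y} → x ∈ filter P? L → y ∈ filter P? L → f x ≈ f y → x ≈ y
        f-injective x∈ y∈ fx≈fy =
          ≈-trans (≈-sym (gf≈id (P-filtered x∈))) (≈-trans (g-cong fx≈fy) (gf≈id (P-filtered y∈)))

        f-into : ∀ {x} → x ∈ filter P? L → f x ∈ filter Q? L
        f-into {x} x∈ = ∈-filter⁺ S Q? Q-resp (complete (f x)) (P⇒Q (P-filtered x∈))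

    count-bijection : ∀ {P Q : A → Set} (P? : Decidable P) (Q? : Decidable Q) →
      (∀ {x y} → x ≈ y → P x → P y) → (∀ {x y} → x ≈ y → Q x → Q y) →
      (f g : A → A) → (∀ {x y} → x ≈ y → f x ≈ f y) → (∀ {x y} → x ≈ y → g x ≈ g y) →
      (∀ {x} → P x → Q (f x)) → (∀ {x} → Q x → P (g x)) →
      (∀ {x} → P x → g (f x) ≈ x) → (∀ {x} → Q x → f (g x) ≈ x) →
      ∃[ k ] (Count P L k × Count Q L k)
    count-bijection P? Q? P-resp Q-resp f g f-cong g-cong P⇒Q Q⇒P gf≈id fg≈id =
      length (filter P? L) , count-filter P? L ,
      subst (Count _ L) #Q≡#P (count-filter Q? L)
      where
        #Q≡#P : length (filter Q? L) ≡ length (filter P? L)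
        #Q≡#P = ℕ.≤-antisym (length-filter-≤ Q? P? Q-resp P-resp g f f-cong Q⇒P fg≈id)
                            (length-filter-≤ P? Q? P-resp Q-resp f g g-cong P⇒Q gf≈id)

  open Pointwise S using (≋-setoid)

  allFns-complete : ∀ {xs} → (∀ x → x ∈ xs) → ∀ m (f : Fin m → A) →
    Membership._∈_ (≋-setoid m) f (allFns m xs)
  allFns-complete complete zero    f = here λ ()
  allFns-complete {xs} complete (suc m) f =
    ∈-concatMap⁺ S (≋-setoid (suc m))
      (Any.map (λ f₀≈x → Any.map⁺ (Any.map (λ f₊≋g → λ { zero → f₀≈x ; (suc i) → f₊≋g i }) tail∈))
               (complete (f zero)))
    where
      tail∈ : Membership._∈_ (≋-setoid m) (f ∘ suc) (allFns m xs)
      tail∈ = allFns-complete complete m (f ∘ suc)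

  module _ {m : ℕ} where
    open Membership (≋-setoid (suc m)) using () renaming (_∈_ to _∈ᵥ_)

    head-of-∈ : ∀ {x v} {us : List (Fin (suc m) → A)} →
      All.All (λ u → u zero ≈ x) us → v ∈ᵥ us → v zero ≈ x
    head-of-∈ (u₀≈x ∷ _)   (here v≋u) = ≈-trans (v≋u zero) u₀≈x
    head-of-∈ (_    ∷ us₀) (there v∈) = head-of-∈ us₀ v∈

    heads-disjoint : ∀ {x y} {us vs : List (Fin (suc m) → A)} →
      All.All (λ u → u zero ≈ x) us → All.All (λ v → v zero ≈ y) vs → ¬ x ≈ y →
      Disjoint (≋-setoid (suc m)) us vs
    heads-disjoint us₀ vs₀ x≉y (v∈us , v∈vs) =
      x≉y (≈-trans (≈-sym (head-of-∈ us₀ v∈us)) (head-of-∈ vs₀ v∈vs))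

  allFns-unique : ∀ {xs} → Unique S xs → ∀ m → Unique (≋-setoid m) (allFns m xs)
  allFns-unique xs! zero    = [] ∷ []
  allFns-unique xs! (suc m) =
    Unique.concat⁺ (≋-setoid (suc m))
      (All.map⁺ (All.universal (λ _ → Unique.map⁺ (≋-setoid m) (≋-setoid (suc m)) (λ eq i → eq (suc i))
                                                    (allFns-unique xs! m)) _))
      (AllPairs.map⁺ (AllPairs.map (heads-disjoint (All.map⁺ (All.universal (λ _ → ≈-refl) _))
                                                   (All.map⁺ (All.universal (λ _ → ≈-refl) _))) xs!))

module _ {V : Set} where

  data Path (R : V → V → Set) : V → V → ℕ → Set where
    []  : ∀ {u} → Path R u u 0
    _∷_ : ∀ {u x v k} → R u x → Path R x v k → Path R u v (suc k)

  private variable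
    R S : V → V → Set
    u v x : V
    k l : ℕ

  map : (∀ {x y} → R x y → S x y) → Path R u v k → Path S u v k
  map f []      = []
  map f (e ∷ p) = f e ∷ map f p

  _++_ : Path R u x k → Path R x v l → Path R u v (k + l)
  []      ++ q = q
  (e ∷ p) ++ q = e ∷ (p ++ q)

  _∷ʳ_ : Path R u x k → R x v → Path R u v (suc k)
  []      ∷ʳ e = e ∷ []
  (d ∷ p) ∷ʳ e = d ∷ (p ∷ʳ e)

  unsnoc : Path R u v (suc k) → ∃[ x ] (Path R u x k × R x v)
  unsnoc (e ∷ [])      = _ , [] , e
  unsnoc (e ∷ (d ∷ p)) with unsnoc (d ∷ p)
  ... | x , q , f = x , e ∷ q , f

  reverse : Path R u v k → Path (flip R) v u k
  reverse []      = []
  reverse (e ∷ p) = reverse p ∷ʳ e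

  Cycle : (V → V → Set) → ℕ → Set
  Cycle R k = ∃[ u ] Path R u u (suc k)

module _ {n : ℕ} where

  Above : (Fin n → Fin n → Set) → Fin n → Fin n → Fin n → Set
  Above R b x y = R x y × b ≤ x × b ≤ y

  private variable
    R : Fin n → Fin n → Set
    b u v : Fin n
    k : ℕ

  Above-weaken : ∀ {b b' x y} → b ≤ b' → Above R b' x y → Above R b x y
  Above-weaken b≤b' (r , b'≤x , b'≤y) = r , ≤-trans b≤b' b'≤x , ≤-trans b≤b' b'≤y

  forget : Path (Above R b) u v k → Path R u v k
  forget = map proj₁

  source-above : Path (Above R b) u b k → b ≤ u
  source-above []              = ≤-refl
  source-above ((_ , b≤u , _) ∷ _) = b≤u

  split-at-minimum : Path R u v k →
    ∃[ b ] ∃[ i ] ∃[ j ] (i + j ≡ k × Path (Above R b) u b i × Path (Above R b) b v j)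
  split-at-minimum [] = _ , 0 , 0 , refl , [] , []
  split-at-minimum {R = R} {u = u} (e ∷ p) with split-at-minimum p
  ... | b , i , j , refl , p₁ , p₂ with u ≤? b
  ...   | yes u≤b = u , 0 , _ , refl , [] ,
            (e , ≤-refl , ≤-trans u≤b (source-above p₁)) ∷ map (Above-weaken {R = R} u≤b) (p₁ ++ p₂)
  ...   | no u≰b = b , suc i , j , refl ,
            (e , ℕ.<⇒≤ (ℕ.≰⇒> u≰b) , source-above p₁) ∷ p₁ , p₂

  rotate-to-minimum : Path R u u k → ∃[ b ] Path (Above R b) b b k
  rotate-to-minimum p with split-at-minimum p
  ... | b , i , j , refl , p₁ , p₂ rewrite ℕ.+-comm i j = b , p₂ ++ p₁

Matrix : ℕ → Set
Matrix n = Fin n → Fin n → Bool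

Matrix-setoid : ℕ → Setoid 0ℓ 0ℓ
Matrix-setoid n = Pointwise.≋-setoid (Pointwise.≋-setoid (≡.setoid Bool) n) n

_≋_ : ∀ {n} → Matrix n → Matrix n → Set
A ≋ B = ∀ r c → A r c ≡ B r c

module _ {n : ℕ} (w : Permutation′ n) where

  Inv : Fin n → Fin n → Set
  Inv i j = i < j × w ⟨$⟩ʳ j < w ⟨$⟩ʳ i

  Inv? : ∀ i j → Dec (Inv i j)
  Inv? i j = (i <? j) ×-dec (w ⟨$⟩ʳ j <? w ⟨$⟩ʳ i)

  Edge? : ∀ i j → Dec (Edge w i j)
  Edge? i j = Inv? i j ⊎-dec Inv? j i

  ⟨$⟩ʳ-injective : ∀ {i j} → w ⟨$⟩ʳ i ≡ w ⟨$⟩ʳ j → i ≡ j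
  ⟨$⟩ʳ-injective eq = trans (sym (inverseˡ w)) (trans (cong (w ⟨$⟩ˡ_) eq) (inverseˡ w))

  Edge-irrefl : ∀ {i} → ¬ Edge w i i
  Edge-irrefl (inj₁ (i<i , _)) = <-irrefl refl i<i
  Edge-irrefl (inj₂ (i<i , _)) = <-irrefl refl i<i

  Edge⇒Inv : ∀ {i j} → Edge w i j → i < j → Inv i j
  Edge⇒Inv (inj₁ inv)       _   = inv
  Edge⇒Inv (inj₂ (j<i , _)) i<j = contradiction j<i (<-asym i<j)

  ¬Edge⇒monotone : ∀ {i j} → i < j → ¬ Edge w i j → w ⟨$⟩ʳ i < w ⟨$⟩ʳ j
  ¬Edge⇒monotone {i} {j} i<j ¬e with <-cmp (w ⟨$⟩ʳ i) (w ⟨$⟩ʳ j)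
  ... | tri< lt _ _ = lt
  ... | tri≈ _ eq _ = contradiction (⟨$⟩ʳ-injective eq) (<⇒≢ i<j)
  ... | tri> _ _ gt = contradiction (inj₁ (i<j , gt)) ¬e

  Inv-trans : ∀ {i j k} → Inv i j → Inv j k → Inv i k
  Inv-trans (i<j , wj<wi) (j<k , wk<wj) = <-trans i<j j<k , <-trans wk<wj wj<wi

  triangle-free : ∀ {R : Fin n → Fin n → Set} → (∀ {x y} → R x y → Edge w x y) →
    (∀ {p q r} → Inv p q → Inv q r → R p q → R q r → ¬ R r p) →
    (∀ {p q r} → Inv p q → Inv q r → R p r → R r q → ¬ R q p) →
    ∀ {x y z} → R x y → R y z → ¬ R z x
  triangle-free {R} arc⇒edge ascending descending = anywhere
    where
      from-leftmost : ∀ {x y z} → x < y → x < z → R x y → R y z → ¬ R z x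
      from-leftmost {y = y} {z} x<y x<z rxy ryz rzx with <-cmp y z
      ... | tri< y<z _ _ =
        ascending (Edge⇒Inv (arc⇒edge rxy) x<y) (Edge⇒Inv (arc⇒edge ryz) y<z) rxy ryz rzx
      ... | tri≈ _ refl _ = Edge-irrefl (arc⇒edge ryz)
      ... | tri> _ _ z<y =
        descending (Edge⇒Inv (swap (arc⇒edge rzx)) x<z) (Edge⇒Inv (swap (arc⇒edge ryz)) z<y) rxy ryz rzx

      anywhere : ∀ {x y z} → R x y → R y z → ¬ R z x
      anywhere {x} {y} {z} rxy ryz rzx with <-cmp x y
      ... | tri≈ _ refl _ = Edge-irrefl (arc⇒edge rxy)
      ... | tri< x<y _ _ with <-cmp x z
      ...   | tri< x<z _ _ = from-leftmost x<y x<z rxy ryz rzx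
      ...   | tri≈ _ refl _ = Edge-irrefl (arc⇒edge rzx)
      ...   | tri> _ _ z<x = from-leftmost z<x (<-trans z<x x<y) rzx rxy ryz
      anywhere {x} {y} {z} rxy ryz rzx | tri> _ _ y<x with <-cmp y z
      ...   | tri< y<z _ _ = from-leftmost y<z y<x ryz rzx rxy
      ...   | tri≈ _ refl _ = Edge-irrefl (arc⇒edge ryz)
      ...   | tri> _ _ z<y = from-leftmost (<-trans z<y y<x) z<y rzx rxy ryz

  record LocallyAcyclicOrientation (R : Fin n → Fin n → Set) : Set where
    field
      arc⇒edge    : ∀ {x y} → R x y → Edge w x y
      edge⇒arc    : ∀ {x y} → Edge w x y → R x y ⊎ R y x
      asym        : ∀ {x y} → R x y → ¬ R y x
      no-triangle : ∀ {x y z} → R x y → R y z → ¬ R z x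
      no-square   : ∀ {x y z t} → Inv x y → Inv x t → Inv z y → Inv z t →
                    R x y → R y z → R z t → ¬ R t x

    irrefl : ∀ {x} → ¬ R x x
    irrefl r = Edge-irrefl (arc⇒edge r)

    arc⇒Inv : ∀ {x y} → R x y → x < y → Inv x y
    arc⇒Inv r = Edge⇒Inv (arc⇒edge r)

    arc⇒Inv⁻¹ : ∀ {x y} → R x y → y < x → Inv y x
    arc⇒Inv⁻¹ r = Edge⇒Inv (swap (arc⇒edge r))

  transpose : ∀ {R} → LocallyAcyclicOrientation R → LocallyAcyclicOrientation (flip R)
  transpose L = record
    { arc⇒edge    = λ r → swap (arc⇒edge r)
    ; edge⇒arc    = λ e → edge⇒arc (swap e)
    ; asym        = flip asym
    ; no-triangle = λ r s t → no-triangle t s r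
    ; no-square   = λ xy xt zy zt r s t u → no-square xt xy zt zy u t s r
    }
    where open LocallyAcyclicOrientation L

  module SuccessorCase {R} (L : LocallyAcyclicOrientation R) where
    open LocallyAcyclicOrientation L

    shorten-via-successor : ∀ {b c d a m} → Inv b c → Inv b a → c < a →
      R b c → R c d → b ≤ d → Path R d a m → R a b → ∃[ k ] (k ℕ.< suc (suc m) × Cycle R k)
    shorten-via-successor {b} {d = d} {m = m} bc ba c<a rbc rcd b≤d p rab with d ≟ b
    ... | yes refl = contradiction rcd (asym rbc)
    ... | no d≢b with Edge? b d
    ...   | yes bd with edge⇒arc bd
    ...     | inj₁ rbd = suc m , ℕ.≤-refl , b , rbd ∷ (p ∷ʳ rab)
    ...     | inj₂ rdb = contradiction rdb (no-triangle rbc rcd)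
    shorten-via-successor {d = d} {m = m} bc ba c<a rbc rcd b≤d p rab | no d≢b | no ¬bd
      with ¬Edge⇒monotone (≤∧≢⇒< b≤d (d≢b ∘ sym)) ¬bd | arc⇒edge rcd
    ...   | wb<wd | inj₁ (_ , wd<wc) = contradiction (<-trans wd<wc (proj₂ bc)) (<-asym wb<wd)
    ...   | wb<wd | inj₂ dc@(d<c , _) with <-trans d<c c<a , <-trans (proj₂ ba) wb<wd
    ...     | da with edge⇒arc (inj₁ da)
    ...       | inj₁ rda = contradiction rab (no-square bc ba dc da rbc rcd rda)
    ...       | inj₂ rad = m , ℕ.m<n⇒m<1+n ℕ.≤-refl , d , p ∷ʳ rad

  module _ {R} (L : LocallyAcyclicOrientation R) where
    open LocallyAcyclicOrientation L

    Inv-from-bound : ∀ {b c} → Above R b b c → Inv b c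
    Inv-from-bound (rbc , _ , b≤c) = arc⇒Inv rbc (≤∧≢⇒< b≤c λ { refl → irrefl rbc })

    Inv-to-bound : ∀ {b a} → Above R b a b → Inv b a
    Inv-to-bound (rab , b≤a , _) = arc⇒Inv⁻¹ rab (≤∧≢⇒< b≤a λ { refl → irrefl rab })

    shorten-at-root : ∀ {b c a m} → Inv b c → Inv b a →
      R b c → Path (Above R b) c a m → R a b → ∃[ k ] (k ℕ.< suc m × Cycle R k)
    shorten-at-root _ _ rbc [] rab = contradiction rab (asym rbc)
    shorten-at-root {c = c} {a} bc ba rbc q@(_ ∷ _) rab with c ≟ a
    ... | yes refl = _ , ℕ.m<n⇒m<1+n ℕ.≤-refl , c , forget q
    ... | no c≢a with Edge? a c
    ...   | yes ac with edge⇒arc ac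
    ...     | inj₁ rac = _ , ℕ.≤-refl , c , forget q ∷ʳ rac
    ...     | inj₂ rca = contradiction rab (no-triangle rbc rca)
    shorten-at-root {c = c} {a} bc ba rbc q@((rcd , _ , b≤d) ∷ q') rab | no c≢a | no _
      with <-cmp c a
    ... | tri≈ _ c≡a _ = contradiction c≡a c≢a
    ... | tri< c<a _ _ = SuccessorCase.shorten-via-successor L bc ba c<a rbc rcd b≤d (forget q') rab
    ... | tri> _ _ a<c with unsnoc q
    -- Reversing all arcs turns this into the case c < a.
    ...   | z , q'' , (rza , b≤z , _)
      with SuccessorCase.shorten-via-successor (transpose L) ba bc a<c rab rza b≤z
             (reverse (forget q'')) rbc
    ...     | k , k<m , u , p = k , k<m , u , reverse p

    shorten : ∀ {b k} → Path (Above R b) b b (suc k) → ∃[ k' ] (k' ℕ.< k × Cycle R k')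
    shorten {k = zero}  ((rbb , _) ∷ []) = contradiction rbb irrefl
    shorten {k = suc m} (e ∷ p) with unsnoc p
    ... | a , q , e' = shorten-at-root (Inv-from-bound e) (Inv-to-bound e') (proj₁ e) q (proj₁ e')

    acyclic : ∀ k → ¬ Cycle R k
    acyclic = <-rec (λ k → ¬ Cycle R k) step
      where
        step : ∀ k → (∀ {k'} → k' ℕ.< k → ¬ Cycle R k') → ¬ Cycle R k
        step k no-shorter (u , p) with rotate-to-minimum p
        ... | b , q with shorten q
        ... | k' , k'<k , c = no-shorter k'<k c

  Inv⇒InE : ∀ {r j} → Inv r j → InE w r (w ⟨$⟩ʳ j)
  Inv⇒InE (r<j , wj<wr) = _ , r<j , wj<wr , refl

  InE⇒Inv : ∀ {r j} → InE w r (w ⟨$⟩ʳ j) → Inv r j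
  InE⇒Inv (_ , r<j , wj<wr , eq) with ⟨$⟩ʳ-injective eq
  ... | refl = r<j , wj<wr

  InE? : ∀ r c → Dec (InE w r c)
  InE? r c = any? λ j → (r <? j) ×-dec (w ⟨$⟩ʳ j <? w ⟨$⟩ʳ r) ×-dec (c ≟ w ⟨$⟩ʳ j)

  Arc : Matrix n → Fin n → Fin n → Set
  Arc O x y = O x y ≡ true

  -- The cell (i , w j) of E_w records the direction of the edge {i , j}, i < j: 1 means i → j.
  toOrientation : Matrix n → Fin n → Fin n → Bool
  toOrientation A i j with Inv? i j | Inv? j i
  ... | yes _ | _     = A i (w ⟨$⟩ʳ j)
  ... | no _  | yes _ = not (A j (w ⟨$⟩ʳ i))
  ... | no _  | no _  = false

  toFilling : Matrix n → Fin n → Fin n → Bool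
  toFilling O r c with InE? r c
  ... | yes (j , _) = O r j
  ... | no _        = false

  module _ {A : Matrix n} where

    toOrientation-Inv : ∀ {i j} → Inv i j → toOrientation A i j ≡ A i (w ⟨$⟩ʳ j)
    toOrientation-Inv {i} {j} ij with Inv? i j
    ... | yes _  = refl
    ... | no ¬ij = contradiction ij ¬ij

    toOrientation-Inv⁻¹ : ∀ {i j} → Inv j i → toOrientation A i j ≡ not (A j (w ⟨$⟩ʳ i))
    toOrientation-Inv⁻¹ {i} {j} ji with Inv? i j | Inv? j i
    ... | yes (i<j , _) | _      = contradiction (proj₁ ji) (<-asym i<j)
    ... | no _          | yes _  = refl
    ... | no _          | no ¬ji = contradiction ji ¬ji

    toOrientation-¬Edge : ∀ {i j} → ¬ Edge w i j → toOrientation A i j ≡ false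
    toOrientation-¬Edge {i} {j} ¬e with Inv? i j | Inv? j i
    ... | yes ij | _      = contradiction (inj₁ ij) ¬e
    ... | no _   | yes ji = contradiction (inj₂ ji) ¬e
    ... | no _   | no _   = refl

  module _ {O : Matrix n} where

    toFilling-Inv : ∀ {r j} → Inv r j → toFilling O r (w ⟨$⟩ʳ j) ≡ O r j
    toFilling-Inv {r} {j} rj with InE? r (w ⟨$⟩ʳ j)
    ... | yes (_ , _ , _ , eq) = cong (O r) (⟨$⟩ʳ-injective (sym eq))
    ... | no ¬e                = contradiction (Inv⇒InE rj) ¬e

    toFilling-¬InE : ∀ {r c} → ¬ InE w r c → toFilling O r c ≡ false
    toFilling-¬InE {r} {c} ¬e with InE? r c
    ... | yes e = contradiction e ¬e
    ... | no _  = refl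

  toOrientation-locallyAcyclic : ∀ {A} → PPAFilling w A →
    LocallyAcyclicOrientation (Arc (toOrientation A))
  toOrientation-locallyAcyclic {A} (_ , conditionA , conditionB) = record
    { arc⇒edge    = arc⇒edge
    ; edge⇒arc    = edge⇒arc
    ; asym        = λ {x} {y} → asym {x} {y}
    ; no-triangle = λ {x} {y} {z} → triangle-free {R = R} arc⇒edge ascending descending {x} {y} {z}
    ; no-square   = λ {x} {y} {z} {t} xy xt zy zt rxy ryz rzt rtx →
        proj₁ (conditionA _ _ _ _ (Inv⇒InE xy) (Inv⇒InE zy) (Inv⇒InE xt) (Inv⇒InE zt))
              (forward xy rxy , forward zt rzt , backward zy ryz , backward xt rtx)
    }
    where
      R : Fin n → Fin n → Set
      R = Arc (toOrientation A)

      forward : ∀ {x y} → Inv x y → R x y → A x (w ⟨$⟩ʳ y) ≡ true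
      forward xy r = trans (sym (toOrientation-Inv xy)) r

      backward : ∀ {x y} → Inv y x → R x y → A y (w ⟨$⟩ʳ x) ≡ false
      backward yx r = not-injective (trans (sym (toOrientation-Inv⁻¹ yx)) r)

      arc⇒edge : ∀ {x y} → R x y → Edge w x y
      arc⇒edge {x} {y} r with Edge? x y
      ... | yes e  = e
      ... | no ¬e  = contradiction (trans (sym r) (toOrientation-¬Edge ¬e)) λ ()

      edge⇒arc : ∀ {x y} → Edge w x y → R x y ⊎ R y x
      edge⇒arc {x} {y} (inj₁ xy) with A x (w ⟨$⟩ʳ y) in eq
      ... | true  = inj₁ (trans (toOrientation-Inv xy) eq)
      ... | false = inj₂ (trans (toOrientation-Inv⁻¹ xy) (cong not eq))
      edge⇒arc (inj₂ yx) = swap (edge⇒arc (inj₁ yx))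

      asym-Inv : ∀ {x y} → Inv x y → R x y → ¬ R y x
      asym-Inv xy r s = not-¬ (sym (forward xy r)) (sym (trans (sym (toOrientation-Inv⁻¹ xy)) s))

      asym : ∀ {x y} → R x y → ¬ R y x
      asym {x} {y} r s = [ (λ xy → asym-Inv xy r s) , (λ yx → asym-Inv yx s r) ]′ (arc⇒edge {x} {y} r)

      triangle : ∀ {p q r} → Inv p q → Inv q r →
        ¬ (A p (w ⟨$⟩ʳ r) ≡ true × A q (w ⟨$⟩ʳ r) ≡ false × A p (w ⟨$⟩ʳ q) ≡ false) ×
        ¬ (A p (w ⟨$⟩ʳ r) ≡ false × A q (w ⟨$⟩ʳ r) ≡ true × A p (w ⟨$⟩ʳ q) ≡ true)
      triangle {p} {q} {r} pq qr =
        conditionB p q (w ⟨$⟩ʳ r) (w ⟨$⟩ʳ q) (Inv⇒InE (Inv-trans pq qr)) (Inv⇒InE qr) (Inv⇒InE pq) refl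

      ascending : ∀ {p q r} → Inv p q → Inv q r → R p q → R q r → ¬ R r p
      ascending pq qr rpq rqr rrp =
        proj₂ (triangle pq qr) (backward (Inv-trans pq qr) rrp , forward qr rqr , forward pq rpq)

      descending : ∀ {p q r} → Inv p q → Inv q r → R p r → R r q → ¬ R q p
      descending pq qr rpr rrq rqp =
        proj₁ (triangle pq qr) (forward (Inv-trans pq qr) rpr , backward qr rrq , backward pq rqp)

  walk⇒path : ∀ {O u v} k → Walk O u v k → Path (Arc O) u v k
  walk⇒path zero    refl        = []
  walk⇒path (suc k) (_ , e , p) = e ∷ walk⇒path k p

  locallyAcyclic⇒acyclicOrientation : ∀ {O} → LocallyAcyclicOrientation (Arc O) →
    AcyclicOrientation w O
  locallyAcyclic⇒acyclicOrientation {O} L =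
    ((λ _ _ → arc⇒edge) , exactly-one) , λ v k walk → acyclic L k (v , walk⇒path (suc k) walk)
    where
      open LocallyAcyclicOrientation L
      exactly-one : ∀ i j → Edge w i j →
        (O i j ≡ true × O j i ≡ false) ⊎ (O i j ≡ false × O j i ≡ true)
      exactly-one i j e with edge⇒arc e
      ... | inj₁ r = inj₁ (r , ¬-not (asym r))
      ... | inj₂ r = inj₂ (¬-not (asym r) , r)

  toFilling-PPA : ∀ {O} → AcyclicOrientation w O → PPAFilling w (toFilling O)
  toFilling-PPA {O} ((_ , exactly-one) , acyclic) = supported , conditionA , conditionB
    where
      one⇒arc : ∀ {r j} → InE w r (w ⟨$⟩ʳ j) → toFilling O r (w ⟨$⟩ʳ j) ≡ true → Arc O r j
      one⇒arc e h = trans (sym (toFilling-Inv (InE⇒Inv e))) h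

      zero⇒arc : ∀ {r j} → InE w r (w ⟨$⟩ʳ j) → toFilling O r (w ⟨$⟩ʳ j) ≡ false → Arc O j r
      zero⇒arc e h with exactly-one _ _ (inj₁ (InE⇒Inv e))
      ... | inj₁ (t , _) = contradiction (trans (sym t) (trans (sym (toFilling-Inv (InE⇒Inv e))) h)) λ ()
      ... | inj₂ (_ , t) = t

      triangle : ∀ {x y z} → Arc O x y → Arc O y z → ¬ Arc O z x
      triangle a b c = acyclic _ 2 (_ , a , _ , b , _ , c , refl)

      square : ∀ {x y z t} → Arc O x y → Arc O y z → Arc O z t → ¬ Arc O t x
      square a b c d = acyclic _ 3 (_ , a , _ , b , _ , c , _ , d , refl)

      supported : SupportedOn w (toFilling O)
      supported r c h =
        decidable-stable (InE? r c) λ ¬e → contradiction (trans (sym h) (toFilling-¬InE ¬e)) λ ()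

      conditionA : ConditionA w (toFilling O)
      conditionA _ _ _ _ e₁@(_ , _ , _ , refl) e₂ e₃@(_ , _ , _ , refl) e₄ =
        (λ (h₁ , h₂ , h₃ , h₄) → square (one⇒arc e₁ h₁) (zero⇒arc e₂ h₃) (one⇒arc e₄ h₂) (zero⇒arc e₃ h₄)) ,
        (λ (h₁ , h₂ , h₃ , h₄) → square (one⇒arc e₃ h₄) (zero⇒arc e₄ h₂) (one⇒arc e₂ h₃) (zero⇒arc e₁ h₁))

      conditionB : ConditionB w (toFilling O)
      conditionB _ _ _ _ e₁@(_ , _ , _ , refl) e₂ e₃ refl =
        (λ (h₁ , h₂ , h₃) → triangle (one⇒arc e₁ h₁) (zero⇒arc e₂ h₂) (zero⇒arc e₃ h₃)) ,
        (λ (h₁ , h₂ , h₃) → triangle (one⇒arc e₃ h₃) (one⇒arc e₂ h₂) (zero⇒arc e₁ h₁))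

  toFilling-toOrientation : ∀ {A} → SupportedOn w A → toFilling (toOrientation A) ≋ A
  toFilling-toOrientation {A} supported r c with InE? r c
  ... | yes (_ , r<j , wj<wr , refl) = toOrientation-Inv (r<j , wj<wr)
  ... | no ¬e = sym (¬-not (¬e ∘ supported r c))

  toOrientation-toFilling : ∀ {O} → IsOrientation w O → toOrientation (toFilling O) ≋ O
  toOrientation-toFilling {O} (arc⇒edge , exactly-one) i j with Edge? i j
  ... | yes (inj₁ ij) = trans (toOrientation-Inv ij) (toFilling-Inv ij)
  ... | yes (inj₂ ji) = trans (toOrientation-Inv⁻¹ ji) (trans (cong not (toFilling-Inv ji)) opposite)
    where
      opposite : not (O j i) ≡ O i j
      opposite with exactly-one i j (inj₂ ji)
      ... | inj₁ (tt , ff) = trans (cong not ff) (sym tt)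
      ... | inj₂ (ff , tt) = trans (cong not tt) (sym ff)
  ... | no ¬e = trans (toOrientation-¬Edge ¬e) (sym (¬-not (¬e ∘ arc⇒edge i j)))

  toOrientation-cong : ∀ {A B} → A ≋ B → toOrientation A ≋ toOrientation B
  toOrientation-cong A≋B i j with Inv? i j | Inv? j i
  ... | yes _ | _     = A≋B i (w ⟨$⟩ʳ j)
  ... | no _  | yes _ = cong not (A≋B j (w ⟨$⟩ʳ i))
  ... | no _  | no _  = refl

  toFilling-cong : ∀ {O O'} → O ≋ O' → toFilling O ≋ toFilling O'
  toFilling-cong O≋O' r c with InE? r c
  ... | yes (j , _) = O≋O' r j
  ... | no _        = refl

  PPAFilling-resp : ∀ {A B} → A ≋ B → PPAFilling w A → PPAFilling w B
  PPAFilling-resp {A} {B} A≋B (supported , conditionA , conditionB) =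
    (λ r c h → supported r c (via h)) ,
    (λ i i' j j' e₁ e₂ e₃ e₄ → let (¬p , ¬q) = conditionA i i' j j' e₁ e₂ e₃ e₄ in
       (λ (h₁ , h₂ , h₃ , h₄) → ¬p (via h₁ , via h₂ , via h₃ , via h₄)) ,
       (λ (h₁ , h₂ , h₃ , h₄) → ¬q (via h₁ , via h₂ , via h₃ , via h₄))) ,
    (λ i i' j j' e₁ e₂ e₃ e₄ → let (¬p , ¬q) = conditionB i i' j j' e₁ e₂ e₃ e₄ in
       (λ (h₁ , h₂ , h₃) → ¬p (via h₁ , via h₂ , via h₃)) ,
       (λ (h₁ , h₂ , h₃) → ¬q (via h₁ , via h₂ , via h₃)))
    where
      via : ∀ {r c b} → B r c ≡ b → A r c ≡ b
      via {r} {c} = trans (A≋B r c)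

  AcyclicOrientation-resp : ∀ {O O'} → O ≋ O' → AcyclicOrientation w O → AcyclicOrientation w O'
  AcyclicOrientation-resp {O} {O'} O≋O' ((arc⇒edge , exactly-one) , acyclic) =
    ((λ i j h → arc⇒edge i j (trans (O≋O' i j) h)) ,
     (λ i j e → Sum.map (Product.map (back i j) (back j i)) (Product.map (back i j) (back j i))
                        (exactly-one i j e))) ,
    λ v k walk → acyclic v k (pull (suc k) walk)
    where
      back : ∀ i j {b} → O i j ≡ b → O' i j ≡ b
      back i j = trans (sym (O≋O' i j))

      pull : ∀ {u v} k → Walk O' u v k → Walk O u v k
      pull zero    u≡v         = u≡v
      pull (suc k) (x , h , p) = x , trans (O≋O' _ x) h , pull k p

  PPAFilling? : ∀ A → Dec (PPAFilling w A)
  PPAFilling? A =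
    all? (λ r → all? λ c → (A r c ≟ᵇ true) →-dec InE? r c) ×-dec
    all? (λ i → all? λ i' → all? λ j → all? λ j' →
      InE? i j →-dec InE? i' j →-dec InE? i j' →-dec InE? i' j' →-dec
        ¬? ((A i j ≟ᵇ true) ×-dec (A i' j' ≟ᵇ true) ×-dec (A i' j ≟ᵇ false) ×-dec (A i j' ≟ᵇ false)) ×-dec
        ¬? ((A i j ≟ᵇ false) ×-dec (A i' j' ≟ᵇ false) ×-dec (A i' j ≟ᵇ true) ×-dec (A i j' ≟ᵇ true))) ×-dec
    all? (λ i → all? λ i' → all? λ j → all? λ j' →
      InE? i j →-dec InE? i' j →-dec InE? i j' →-dec (j' ≟ w ⟨$⟩ʳ i') →-dec
        ¬? ((A i j ≟ᵇ true) ×-dec (A i' j ≟ᵇ false) ×-dec (A i j' ≟ᵇ false)) ×-dec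
        ¬? ((A i j ≟ᵇ false) ×-dec (A i' j ≟ᵇ true) ×-dec (A i j' ≟ᵇ true)))

  PPA⇒acyclicOrientation : ∀ {A} → PPAFilling w A → AcyclicOrientation w (toOrientation A)
  PPA⇒acyclicOrientation = locallyAcyclic⇒acyclicOrientation ∘ toOrientation-locallyAcyclic

  -- Acyclicity is decided through the bijection: O is an acyclic orientation
  -- iff its filling is pseudo-percentage-avoiding and is mapped back to O.
  AcyclicOrientation? : ∀ O → Dec (AcyclicOrientation w O)
  AcyclicOrientation? O
    with PPAFilling? (toFilling O) | all? (λ i → all? λ j → toOrientation (toFilling O) i j ≟ᵇ O i j)
  ... | yes ppa | yes back = yes (AcyclicOrientation-resp back (PPA⇒acyclicOrientation ppa))
  ... | no ¬ppa | _        = no (¬ppa ∘ toFilling-PPA)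
  ... | yes _   | no ¬back = no (¬back ∘ toOrientation-toFilling ∘ proj₁)

module _ (n : ℕ) where
  open Membership (Matrix-setoid n) using (_∈_)

  allMatrices-complete : ∀ A → A ∈ allMatrices n
  allMatrices-complete =
    allFns-complete (Pointwise.≋-setoid (≡.setoid Bool) n) (allFns-complete (≡.setoid Bool) bool-in n) n
    where
      bool-in : ∀ b → Membership._∈_ (≡.setoid Bool) b (true ∷ false ∷ [])
      bool-in true  = here refl
      bool-in false = there (here refl)

  allMatrices-unique : Unique (Matrix-setoid n) (allMatrices n)
  allMatrices-unique =
    allFns-unique (Pointwise.≋-setoid (≡.setoid Bool) n) (allFns-unique (≡.setoid Bool) true≢false n) n
    where
      true≢false : Unique (≡.setoid Bool) (true ∷ false ∷ [])
      true≢false = ((λ ()) ∷ []) ∷ [] ∷ []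

proposition2p4 : (n : ℕ) (w : Permutation′ n) →
    ∃[ k ] (Count (PPAFilling w) (allMatrices n) k ×
            Count (AcyclicOrientation w) (allMatrices n) k)
proposition2p4 n w =
  count-bijection (Matrix-setoid n) (allMatrices-complete n) (allMatrices-unique n)
    (PPAFilling? w) (AcyclicOrientation? w) (PPAFilling-resp w) (AcyclicOrientation-resp w)
    (toOrientation w) (toFilling w) (toOrientation-cong w) (toFilling-cong w)
    (PPA⇒acyclicOrientation w) (toFilling-PPA w)
    (λ ppa → toFilling-toOrientation w (proj₁ ppa)) (λ ao → toOrientation-toFilling w (proj₁ ao))
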